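{- Let $(V,(w_{ij})_{i,j\in V})$ be a finite weighted graph with symmetric nonnegative weights, $\deg(i)=\sum_{j\in V}w_{ij}$, $\mathrm{vol}(A)=\sum_{i\in A}\deg(i)$, $\mathrm{vol}(V)>0$, and modularity $Q(A)=\sum_{i,j\in A}w_{ij}-\mathrm{vol}(A)^2/\mathrm{vol}(V)$ (sum over ordered pairs). Let $\tilde w_{ij}=w_{ij}-\deg(i)\deg(j)/\mathrm{vol}(V)$ and $s_{ij}=\mathrm{sign}(\tilde w_{ij})$. Then the frustration index of the signed weighted graph $(V,(\tilde w_{ij}))$, $$\min_{\vec x\in\{ -1,1\}^V}\sum_{\{i,j\}}|\tilde w_{ij}|\,|x_i-s_{ij}x_j|,$$ equals $2\Big(\sum_{\{i,j\}:\tilde w_{ij}<0}|\tilde w_{ij}|-\max_{A\subseteq V}Q(A)\Big)$, where $\sum_{\{i,j\}}$ denotes summation over unordered pairs of distinct vertices.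
   Context: In the signed weighted graph, $\{i,j\}$ is a positive edge if $\tilde w_{ij}>0$ and a negative edge if $\tilde w_{ij}<0$.
   Formalization: The weights $w_{ij}$ of the weighted graph are rational. -}

module Defs where

open import Data.Nat using (ℕ; zero; suc)
open import Data.Bool using (Bool; true; false; if_then_else_)
open import Data.Fin using (Fin; toℕ; zero; suc)
open import Data.Nat using (_<ᵇ_)
open import Data.Rational using (ℚ; 0ℚ; 1ℚ; _+_; _-_; _*_; -_; _÷_; ∣_∣; _<_; _≤_; >-nonZero)
open import Data.Rational.Properties using (_<?_)
open import Relation.Nullary using (yes; no)
open import Data.Product using (Σ; _×_)
open import Relation.Binary.PropositionalEquality using (_≡_)

Σ[_] : {n : ℕ} → (Fin n → ℚ) → ℚ
Σ[_] {zero} f = 0ℚ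
Σ[_] {suc n} f = f zero + Σ[_] {n} (λ i → f (suc i))

Weights : ℕ → Set
Weights n = Fin n → Fin n → ℚ

Subset : ℕ → Set
Subset n = Fin n → Bool

[_]_ : Bool → ℚ → ℚ
[ b ] q = if b then q else 0ℚ

deg : {n : ℕ} → Weights n → Fin n → ℚ
deg w i = Σ[ (λ j → w i j) ]

vol : {n : ℕ} → Weights n → Subset n → ℚ
vol w A = Σ[ (λ i → [ A i ] deg w i) ]

volV : {n : ℕ} → Weights n → ℚ
volV w = Σ[ (λ i → deg w i) ]

modularity : {n : ℕ} (w : Weights n) → 0ℚ < volV w → Subset n → ℚ
modularity w vp A =
  Σ[ (λ i → Σ[ (λ j → [ A i ] ([ A j ] w i j)) ]) ]
    - ((vol w A * vol w A) ÷ volV w) {{>-nonZero vp}}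

wt : {n : ℕ} (w : Weights n) → 0ℚ < volV w → Weights n
wt w vp i j = w i j - ((deg w i * deg w j) ÷ volV w) {{>-nonZero vp}}

sign : ℚ → ℚ
sign q with 0ℚ <? q
... | yes _ = 1ℚ
... | no _ with q <? 0ℚ
...   | yes _ = - 1ℚ
...   | no _ = 0ℚ

pairSum : {n : ℕ} → (Fin n → Fin n → ℚ) → ℚ
pairSum f = Σ[ (λ i → Σ[ (λ j → [ toℕ i <ᵇ toℕ j ] f i j) ]) ]

spin : Bool → ℚ
spin true = 1ℚ
spin false = - 1ℚ

frustration : {n : ℕ} (w : Weights n) → 0ℚ < volV w → (Fin n → Bool) → ℚ
frustration w vp x =
  pairSum (λ i j → ∣ wt w vp i j ∣ * ∣ spin (x i) - sign (wt w vp i j) * spin (x j) ∣)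

negWeight : {n : ℕ} (w : Weights n) → 0ℚ < volV w → ℚ
negWeight w vp = pairSum (λ i j → neg (wt w vp i j))
  where
  neg : ℚ → ℚ
  neg q with q <? 0ℚ
  ... | yes _ = ∣ q ∣
  ... | no _ = 0ℚ

IsMin : {X : Set} → (X → ℚ) → ℚ → Set
IsMin {X} f m = Σ X (λ x → f x ≡ m) × ((x : X) → m ≤ f x)

IsMax : {X : Set} → (X → ℚ) → ℚ → Set
IsMax {X} f m = Σ X (λ x → f x ≡ m) × ((x : X) → f x ≤ m)

-- Flipping a spin x_j relative to x_i turns the frustration of the edge {i,j} from the
-- negative part of w̃_ij into that plus w̃_ij, so
--   frustration(x) = 2 (Σ_{w̃_ij < 0} |w̃_ij| + Σ_{i<j, x_i ≠ x_j} w̃_ij).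
-- Because every row of w̃ sums to zero, the cut Σ_{x_i ≠ x_j} w̃_ij of the set A = {x = 1}
-- equals −2 Σ_{i,j ∈ A} w̃_ij = −2 Q(A). Hence frustration(x) = 2 (negWeight − Q(A)), and
-- the antitone map q ↦ 2 (negWeight − q) sends the maximum of Q to the minimum frustration.
module Submission where

open import Defs
open import Algebra.Bundles using (CommutativeRing)
open import Data.Bool using (Bool; true; false; _xor_; T)
open import Data.Bool.Properties using (xor-same; xor-comm)
open import Data.Empty using (⊥-elim)
open import Data.Fin using (Fin; zero; suc; toℕ)
open import Data.Fin.Properties using (toℕ-injective)
open import Data.Nat using (ℕ; zero; suc; _<ᵇ_)
import Data.Nat.Properties as ℕ
open import Data.Product using (Σ; _,_; proj₁; proj₂)
open import Data.Rational using (ℚ; 0ℚ; 1ℚ; ½; _+_; _-_; _*_; -_; ∣_∣; _<_; _≤_; 1/_; >-nonZero)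
open import Data.Rational.Properties
open import Data.Rational.Solver using (module +-*-Solver)
open import Function using (_∘_; flip)
open import Relation.Binary.Definitions using (tri<; tri≈; tri>)
open import Relation.Binary.PropositionalEquality hiding ([_])
open import Relation.Nullary using (yes; no; ¬_)
open import Algebra.Properties.Semiring.Sum (CommutativeRing.semiring +-*-commutativeRing)
  using (sum; sum-cong-≗; sum-replicate-zero; ∑-distrib-+; ∑-comm; *-distribˡ-sum)
open +-*-Solver
open ≡-Reasoning

2ℚ : ℚ
2ℚ = 1ℚ + 1ℚ

Σ≡sum : ∀ {n} (f : Fin n → ℚ) → Σ[ f ] ≡ sum f
Σ≡sum {zero} f = refl
Σ≡sum {suc n} f = cong (f zero +_) (Σ≡sum (f ∘ suc))

Σ-cong : ∀ {n} {f g : Fin n → ℚ} → (∀ i → f i ≡ g i) → Σ[ f ] ≡ Σ[ g ]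
Σ-cong {f = f} {g} f≗g = trans (Σ≡sum f) (trans (sum-cong-≗ f≗g) (sym (Σ≡sum g)))

Σ-zero : ∀ n → Σ[_] {n} (λ _ → 0ℚ) ≡ 0ℚ
Σ-zero n = trans (Σ≡sum {n} (λ _ → 0ℚ)) (sum-replicate-zero n)

Σ-distrib-+ : ∀ {n} (f g : Fin n → ℚ) → Σ[ (λ i → f i + g i) ] ≡ Σ[ f ] + Σ[ g ]
Σ-distrib-+ f g =
  trans (Σ≡sum (λ i → f i + g i)) (trans (∑-distrib-+ f g) (sym (cong₂ _+_ (Σ≡sum f) (Σ≡sum g))))

Σ-distrib-neg : ∀ {n} (f : Fin n → ℚ) → Σ[ (λ i → - f i) ] ≡ - Σ[ f ]
Σ-distrib-neg {zero} f = refl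
Σ-distrib-neg {suc n} f =
  trans (cong (- f zero +_) (Σ-distrib-neg (f ∘ suc))) (sym (neg-distrib-+ (f zero) Σ[ f ∘ suc ]))

Σ-distrib-- : ∀ {n} (f g : Fin n → ℚ) → Σ[ (λ i → f i - g i) ] ≡ Σ[ f ] - Σ[ g ]
Σ-distrib-- f g = trans (Σ-distrib-+ f (λ i → - g i)) (cong (Σ[ f ] +_) (Σ-distrib-neg g))

*-distribˡ-Σ : ∀ {n} c (f : Fin n → ℚ) → c * Σ[ f ] ≡ Σ[ (λ i → c * f i) ]
*-distribˡ-Σ c f = trans (cong (c *_) (Σ≡sum f)) (trans (*-distribˡ-sum c f) (sym (Σ≡sum (λ i → c * f i))))

ΣΣ : ∀ {m k} → (Fin m → Fin k → ℚ) → ℚ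
ΣΣ F = Σ[ (λ i → Σ[ F i ]) ]

ΣΣ-cong : ∀ {m k} {F G : Fin m → Fin k → ℚ} → (∀ i j → F i j ≡ G i j) → ΣΣ F ≡ ΣΣ G
ΣΣ-cong F≗G = Σ-cong (λ i → Σ-cong (F≗G i))

ΣΣ-distrib-+ : ∀ {m k} (F G : Fin m → Fin k → ℚ) →
  ΣΣ (λ i j → F i j + G i j) ≡ ΣΣ F + ΣΣ G
ΣΣ-distrib-+ F G = trans (Σ-cong (λ i → Σ-distrib-+ (F i) (G i))) (Σ-distrib-+ (λ i → Σ[ F i ]) (λ i → Σ[ G i ]))

ΣΣ-distrib-- : ∀ {m k} (F G : Fin m → Fin k → ℚ) →
  ΣΣ (λ i j → F i j - G i j) ≡ ΣΣ F - ΣΣ G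
ΣΣ-distrib-- F G = trans (Σ-cong (λ i → Σ-distrib-- (F i) (G i))) (Σ-distrib-- (λ i → Σ[ F i ]) (λ i → Σ[ G i ]))

*-distribˡ-ΣΣ : ∀ {m k} c (F : Fin m → Fin k → ℚ) → c * ΣΣ F ≡ ΣΣ (λ i j → c * F i j)
*-distribˡ-ΣΣ c F = trans (*-distribˡ-Σ c (λ i → Σ[ F i ])) (Σ-cong (λ i → *-distribˡ-Σ c (F i)))

ΣΣ≡sum-sum : ∀ {m k} (F : Fin m → Fin k → ℚ) → ΣΣ F ≡ sum (λ i → sum (F i))
ΣΣ≡sum-sum {m} F = trans (Σ≡sum {m} (λ i → Σ[ F i ])) (sum-cong-≗ (λ i → Σ≡sum (F i)))

ΣΣ-comm : ∀ {m k} (F : Fin m → Fin k → ℚ) → ΣΣ F ≡ ΣΣ (flip F)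
ΣΣ-comm F = trans (ΣΣ≡sum-sum F) (trans (∑-comm F) (sym (ΣΣ≡sum-sum (flip F))))

ΣΣ-product : ∀ {m k} (f : Fin m → ℚ) (g : Fin k → ℚ) → ΣΣ (λ i j → f i * g j) ≡ Σ[ f ] * Σ[ g ]
ΣΣ-product f g = begin
  ΣΣ (λ i j → f i * g j)      ≡⟨ Σ-cong (λ i → sym (*-distribˡ-Σ (f i) g)) ⟩
  Σ[ (λ i → f i * Σ[ g ]) ]   ≡⟨ Σ-cong (λ i → *-comm (f i) Σ[ g ]) ⟩
  Σ[ (λ i → Σ[ g ] * f i) ]   ≡⟨ sym (*-distribˡ-Σ Σ[ g ] f) ⟩
  Σ[ g ] * Σ[ f ]             ≡⟨ *-comm Σ[ g ] Σ[ f ] ⟩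
  Σ[ f ] * Σ[ g ]             ∎

ΣΣ-scaledRows≡0 : ∀ {m k} (a : Fin m → ℚ) (F : Fin m → Fin k → ℚ) →
  (∀ i → Σ[ F i ] ≡ 0ℚ) → ΣΣ (λ i j → a i * F i j) ≡ 0ℚ
ΣΣ-scaledRows≡0 {m} a F rows≡0 =
  trans (Σ-cong (λ i → trans (sym (*-distribˡ-Σ (a i) (F i)))
                             (trans (cong (a i *_) (rows≡0 i)) (*-zeroʳ (a i)))))
        (Σ-zero m)

𝟙 : Bool → ℚ
𝟙 true = 1ℚ
𝟙 false = 0ℚ

[]≡𝟙* : ∀ b q → [ b ] q ≡ 𝟙 b * q
[]≡𝟙* true q = sym (*-identityˡ q)
[]≡𝟙* false q = sym (*-zeroˡ q)

[]-distrib-+ : ∀ b p q → [ b ] (p + q) ≡ [ b ] p + [ b ] q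
[]-distrib-+ true p q = refl
[]-distrib-+ false p q = refl

[]-distrib-- : ∀ b p q → [ b ] (p - q) ≡ [ b ] p - [ b ] q
[]-distrib-- true p q = refl
[]-distrib-- false p q = refl

[]-*-comm : ∀ b c q → [ b ] (c * q) ≡ c * [ b ] q
[]-*-comm true c q = refl
[]-*-comm false c q = sym (*-zeroʳ c)

[]-T : ∀ {b} q → T b → [ b ] q ≡ q
[]-T {true} q _ = refl

[]-¬T : ∀ {b} q → ¬ T b → [ b ] q ≡ 0ℚ
[]-¬T {true} q ¬t = ⊥-elim (¬t _)
[]-¬T {false} q _ = refl

[]-xor : ∀ a b q → [ a xor b ] q ≡ 𝟙 a * q + (𝟙 b * q - 2ℚ * [ a ] ([ b ] q))
[]-xor true true q = solve 1 (λ q → con 0ℚ := con 1ℚ :* q :+ (con 1ℚ :* q :- con 2ℚ :* q)) refl q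
[]-xor true false q = solve 1 (λ q → q := con 1ℚ :* q :+ (con 0ℚ :* q :- con 2ℚ :* con 0ℚ)) refl q
[]-xor false true q = solve 1 (λ q → q := con 0ℚ :* q :+ (con 1ℚ :* q :- con 2ℚ :* con 0ℚ)) refl q
[]-xor false false q = solve 1 (λ q → con 0ℚ := con 0ℚ :* q :+ (con 0ℚ :* q :- con 2ℚ :* con 0ℚ)) refl q

internalWeight : ∀ {n} → (Fin n → Fin n → ℚ) → Subset n → ℚ
internalWeight W A = ΣΣ (λ i j → [ A i ] ([ A j ] W i j))

-- [x_i ≠ x_j] = x_i + x_j − 2 x_i x_j, and the zero row and column sums kill the linear terms.
ΣΣ-cut : ∀ {n} (W : Fin n → Fin n → ℚ) →
  (∀ i → Σ[ W i ] ≡ 0ℚ) → (∀ j → Σ[ (λ i → W i j) ] ≡ 0ℚ) → ∀ x →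
  ΣΣ (λ i j → [ x i xor x j ] W i j) ≡ - (2ℚ * internalWeight W x)
ΣΣ-cut W rows≡0 cols≡0 x = begin
  ΣΣ (λ i j → [ x i xor x j ] W i j)
    ≡⟨ ΣΣ-cong (λ i j → []-xor (x i) (x j) (W i j)) ⟩
  ΣΣ (λ i j → 𝟙 (x i) * W i j + (𝟙 (x j) * W i j - 2ℚ * [ x i ] ([ x j ] W i j)))
    ≡⟨ ΣΣ-distrib-+ (λ i j → 𝟙 (x i) * W i j) (λ i j → 𝟙 (x j) * W i j - 2ℚ * [ x i ] ([ x j ] W i j)) ⟩
  ΣΣ (λ i j → 𝟙 (x i) * W i j) + ΣΣ (λ i j → 𝟙 (x j) * W i j - 2ℚ * [ x i ] ([ x j ] W i j))
    ≡⟨ cong₂ _+_ (ΣΣ-scaledRows≡0 (𝟙 ∘ x) W rows≡0)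
                 (ΣΣ-distrib-- (λ i j → 𝟙 (x j) * W i j) (λ i j → 2ℚ * [ x i ] ([ x j ] W i j))) ⟩
  0ℚ + (ΣΣ (λ i j → 𝟙 (x j) * W i j) - ΣΣ (λ i j → 2ℚ * [ x i ] ([ x j ] W i j)))
    ≡⟨ cong₂ (λ c d → 0ℚ + (c - d)) columns
             (sym (*-distribˡ-ΣΣ 2ℚ (λ i j → [ x i ] ([ x j ] W i j)))) ⟩
  0ℚ + (0ℚ - 2ℚ * internalWeight W x)
    ≡⟨ solve 1 (λ q → con 0ℚ :+ (con 0ℚ :- q) := :- q) refl (2ℚ * internalWeight W x) ⟩
  - (2ℚ * internalWeight W x) ∎
  where
  columns : ΣΣ (λ i j → 𝟙 (x j) * W i j) ≡ 0ℚ
  columns = trans (ΣΣ-comm (λ i j → 𝟙 (x j) * W i j)) (ΣΣ-scaledRows≡0 (𝟙 ∘ x) (flip W) cols≡0)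

[i<j]+[j<i] : ∀ {n} (i j : Fin n) q → (i ≡ j → q ≡ 0ℚ) →
  q ≡ [ toℕ i <ᵇ toℕ j ] q + [ toℕ j <ᵇ toℕ i ] q
[i<j]+[j<i] i j q diag with ℕ.<-cmp (toℕ i) (toℕ j)
... | tri< i<j _ j≮i = trans (sym (+-identityʳ q))
  (sym (cong₂ _+_ ([]-T q (ℕ.<⇒<ᵇ i<j)) ([]-¬T q (j≮i ∘ ℕ.<ᵇ⇒< _ _))))
... | tri> i≮j _ j<i = trans (sym (+-identityˡ q))
  (sym (cong₂ _+_ ([]-¬T q (i≮j ∘ ℕ.<ᵇ⇒< _ _)) ([]-T q (ℕ.<⇒<ᵇ j<i))))
... | tri≈ i≮j i≡j j≮i = trans (diag (toℕ-injective i≡j))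
  (sym (cong₂ _+_ ([]-¬T q (i≮j ∘ ℕ.<ᵇ⇒< _ _)) ([]-¬T q (j≮i ∘ ℕ.<ᵇ⇒< _ _))))

ΣΣ≡pairSum+pairSum : ∀ {n} (g : Fin n → Fin n → ℚ) →
  (∀ i j → g i j ≡ g j i) → (∀ i → g i i ≡ 0ℚ) → ΣΣ g ≡ pairSum g + pairSum g
ΣΣ≡pairSum+pairSum g symmetric diag = begin
  ΣΣ g
    ≡⟨ ΣΣ-cong (λ i j → [i<j]+[j<i] i j (g i j) (λ { refl → diag i })) ⟩
  ΣΣ (λ i j → [ toℕ i <ᵇ toℕ j ] g i j + [ toℕ j <ᵇ toℕ i ] g i j)
    ≡⟨ ΣΣ-distrib-+ (λ i j → [ toℕ i <ᵇ toℕ j ] g i j) (λ i j → [ toℕ j <ᵇ toℕ i ] g i j) ⟩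
  pairSum g + ΣΣ (λ i j → [ toℕ j <ᵇ toℕ i ] g i j)
    ≡⟨ cong (pairSum g +_) (ΣΣ-comm (λ i j → [ toℕ j <ᵇ toℕ i ] g i j)) ⟩
  pairSum g + ΣΣ (λ j i → [ toℕ j <ᵇ toℕ i ] g i j)
    ≡⟨ cong (pairSum g +_) (ΣΣ-cong (λ j i → cong [ toℕ j <ᵇ toℕ i ]_ (symmetric i j))) ⟩
  pairSum g + pairSum g ∎

pairSum-cong : ∀ {n} {F G : Fin n → Fin n → ℚ} → (∀ i j → F i j ≡ G i j) → pairSum F ≡ pairSum G
pairSum-cong F≗G = ΣΣ-cong (λ i j → cong [ _ ]_ (F≗G i j))

pairSum-distrib-+ : ∀ {n} (F G : Fin n → Fin n → ℚ) →
  pairSum (λ i j → F i j + G i j) ≡ pairSum F + pairSum G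
pairSum-distrib-+ F G = trans (ΣΣ-cong (λ i j → []-distrib-+ _ (F i j) (G i j)))
  (ΣΣ-distrib-+ (λ i j → [ toℕ i <ᵇ toℕ j ] F i j) (λ i j → [ toℕ i <ᵇ toℕ j ] G i j))

pairSum-distribˡ-* : ∀ {n} c (F : Fin n → Fin n → ℚ) →
  pairSum (λ i j → c * F i j) ≡ c * pairSum F
pairSum-distribˡ-* c F = trans (ΣΣ-cong (λ i j → []-*-comm _ c (F i j)))
  (sym (*-distribˡ-ΣΣ c (λ i j → [ toℕ i <ᵇ toℕ j ] F i j)))

pairSum-cut : ∀ {n} (W : Fin n → Fin n → ℚ) → (∀ i j → W i j ≡ W j i) →
  (∀ i → Σ[ W i ] ≡ 0ℚ) → ∀ x →
  pairSum (λ i j → [ x i xor x j ] W i j) ≡ - internalWeight W x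
pairSum-cut W symmetric rows≡0 x = begin
  P                                ≡⟨ solve 1 (λ p → p := con ½ :* (p :+ p)) refl P ⟩
  ½ * (P + P)                      ≡⟨ cong (½ *_) (sym (ΣΣ≡pairSum+pairSum cut cut-symmetric cut-diag)) ⟩
  ½ * ΣΣ cut                       ≡⟨ cong (½ *_) (ΣΣ-cut W rows≡0 cols≡0 x) ⟩
  ½ * - (2ℚ * internalWeight W x)  ≡⟨ solve 1 (λ q → con ½ :* (:- (con 2ℚ :* q)) := :- q) refl _ ⟩
  - internalWeight W x             ∎
  where
  cut : Fin _ → Fin _ → ℚ
  cut i j = [ x i xor x j ] W i j
  P : ℚ
  P = pairSum cut
  cols≡0 : ∀ j → Σ[ (λ i → W i j) ] ≡ 0ℚ
  cols≡0 j = trans (Σ-cong (λ i → symmetric i j)) (rows≡0 j)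
  cut-symmetric : ∀ i j → cut i j ≡ cut j i
  cut-symmetric i j = cong₂ [_]_ (xor-comm (x i) (x j)) (symmetric i j)
  cut-diag : ∀ i → cut i i ≡ 0ℚ
  cut-diag i = cong (λ b → [ b ] W i i) (xor-same (x i))

-- A copy of the summand of negWeight, which Defs keeps local.
negPart : ℚ → ℚ
negPart q with q <? 0ℚ
... | yes _ = ∣ q ∣
... | no _ = 0ℚ

spin-gap : ∀ a b → ∣ spin a - spin b ∣ ≡ 2ℚ * 𝟙 (a xor b)
spin-gap true true = refl
spin-gap true false = refl
spin-gap false true = refl
spin-gap false false = refl

spin-sum : ∀ a b → ∣ spin a + spin b ∣ ≡ 2ℚ * (1ℚ - 𝟙 (a xor b))
spin-sum true true = refl
spin-sum true false = refl
spin-sum false true = refl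
spin-sum false false = refl

edgeFrustration : ∀ q a b →
  ∣ q ∣ * ∣ spin a - sign q * spin b ∣ ≡ 2ℚ * (negPart q + [ a xor b ] q)
edgeFrustration q a b rewrite []≡𝟙* (a xor b) q with 0ℚ <? q
... | yes 0<q with q <? 0ℚ
...   | yes q<0 = ⊥-elim (<-asym 0<q q<0)
...   | no _ = begin
  ∣ q ∣ * ∣ spin a - 1ℚ * spin b ∣
    ≡⟨ cong₂ _*_ (0≤p⇒∣p∣≡p (<⇒≤ 0<q))
                 (trans (cong (λ z → ∣ spin a - z ∣) (*-identityˡ (spin b))) (spin-gap a b)) ⟩
  q * (2ℚ * t)
    ≡⟨ solve 2 (λ q t → q :* (con 2ℚ :* t) := con 2ℚ :* (con 0ℚ :+ t :* q)) refl q t ⟩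
  2ℚ * (0ℚ + t * q) ∎
  where t = 𝟙 (a xor b)
edgeFrustration q a b | no q≯0 with q <? 0ℚ
...   | yes q<0 = begin
  ∣ q ∣ * ∣ spin a - - 1ℚ * spin b ∣
    ≡⟨ cong (λ z → ∣ q ∣ * ∣ z ∣) (solve 2 (λ u v → u :- :- con 1ℚ :* v := u :+ v) refl (spin a) (spin b)) ⟩
  ∣ q ∣ * ∣ spin a + spin b ∣
    ≡⟨ cong₂ _*_ ∣q∣≡-q (spin-sum a b) ⟩
  - q * (2ℚ * (1ℚ - t))
    ≡⟨ solve 2 (λ q t → :- q :* (con 2ℚ :* (con 1ℚ :- t)) := con 2ℚ :* (:- q :+ t :* q)) refl q t ⟩
  2ℚ * (- q + t * q)
    ≡⟨ cong (λ z → 2ℚ * (z + t * q)) (sym ∣q∣≡-q) ⟩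
  2ℚ * (∣ q ∣ + t * q) ∎
  where
  t = 𝟙 (a xor b)
  ∣q∣≡-q : ∣ q ∣ ≡ - q
  ∣q∣≡-q = trans (sym (∣-p∣≡∣p∣ q)) (0≤p⇒∣p∣≡p (neg-antimono-≤ (<⇒≤ q<0)))
...   | no q≮0 with ≤-antisym (≮⇒≥ q≯0) (≮⇒≥ q≮0)
...     | refl = solve 2 (λ u t → con 0ℚ :* u := con 2ℚ :* (con 0ℚ :+ t :* con 0ℚ))
                   refl ∣ spin a - 0ℚ * spin b ∣ (𝟙 (a xor b))

IsMin-cong : ∀ {X : Set} {f g : X → ℚ} {m} → (∀ x → f x ≡ g x) → IsMin f m → IsMin g m
IsMin-cong f≗g ((x , fx≡m) , min) =
  (x , trans (sym (f≗g x)) fx≡m) , λ y → subst (_ ≤_) (f≗g y) (min y)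

IsMax⇒IsMin-antitone : ∀ {X : Set} {f : X → ℚ} {m} (h : ℚ → ℚ) →
  (∀ {p q} → p ≤ q → h q ≤ h p) → IsMax f m → IsMin (h ∘ f) (h m)
IsMax⇒IsMin-antitone h antitone ((x , fx≡m) , max) = (x , cong h fx≡m) , λ y → antitone (max y)

module WeightedGraph {n : ℕ} (w : Weights n) (vp : 0ℚ < volV w) where

  private
    W : Weights n
    W = wt w vp
    d : Fin n → ℚ
    d = deg w
    c : ℚ
    c = (1/ volV w) {{>-nonZero vp}}

  wt-rowSum≡0 : ∀ i → Σ[ W i ] ≡ 0ℚ
  wt-rowSum≡0 i = begin
    Σ[ W i ]                              ≡⟨ Σ-distrib-- (w i) (λ j → d i * d j * c) ⟩
    d i - Σ[ (λ j → d i * d j * c) ]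
      ≡⟨ cong (λ z → d i - z) (Σ-cong (λ j → solve 3 (λ x y z → x :* y :* z := (x :* z) :* y) refl (d i) (d j) c)) ⟩
    d i - Σ[ (λ j → d i * c * d j) ]      ≡⟨ cong (λ z → d i - z) (sym (*-distribˡ-Σ (d i * c) d)) ⟩
    d i - d i * c * volV w                ≡⟨ cong (λ z → d i - z) (*-assoc (d i) c (volV w)) ⟩
    d i - d i * (c * volV w)              ≡⟨ cong (λ z → d i - d i * z) (*-inverseˡ (volV w) {{>-nonZero vp}}) ⟩
    d i - d i * 1ℚ                        ≡⟨ solve 1 (λ x → x :- x :* con 1ℚ := con 0ℚ) refl (d i) ⟩
    0ℚ                                    ∎

  wt-symmetric : (∀ i j → w i j ≡ w j i) → ∀ i j → W i j ≡ W j i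
  wt-symmetric symmetric i j = cong₂ (λ a b → a - b * c) (symmetric i j) (*-comm (d i) (d j))

  modularity≡internalWeight : ∀ A → modularity w vp A ≡ internalWeight W A
  modularity≡internalWeight A = sym (begin
    internalWeight W A
      ≡⟨ ΣΣ-cong (λ i j → trans (cong [ A i ]_ ([]-distrib-- (A j) _ _)) ([]-distrib-- (A i) _ _)) ⟩
    ΣΣ (λ i j → [ A i ] ([ A j ] w i j) - [ A i ] ([ A j ] (d i * d j * c)))
      ≡⟨ ΣΣ-distrib-- (λ i j → [ A i ] ([ A j ] w i j)) (λ i j → [ A i ] ([ A j ] (d i * d j * c))) ⟩
    internalWeight w A - ΣΣ (λ i j → [ A i ] ([ A j ] (d i * d j * c)))
      ≡⟨ cong (λ z → internalWeight w A - z) (ΣΣ-cong (λ i j → separate (A i) (A j) (d i) (d j))) ⟩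
    internalWeight w A - ΣΣ (λ i j → [ A i ] (d i) * (c * [ A j ] (d j)))
      ≡⟨ cong (λ z → internalWeight w A - z) (ΣΣ-product (λ i → [ A i ] (d i)) (λ j → c * [ A j ] (d j))) ⟩
    internalWeight w A - vol w A * Σ[ (λ j → c * [ A j ] (d j)) ]
      ≡⟨ cong (λ z → internalWeight w A - vol w A * z) (sym (*-distribˡ-Σ c (λ j → [ A j ] (d j)))) ⟩
    internalWeight w A - vol w A * (c * vol w A)
      ≡⟨ cong (λ z → internalWeight w A - z) (solve 2 (λ v x → v :* (x :* v) := v :* v :* x) refl (vol w A) c) ⟩
    modularity w vp A ∎)
    where
    separate : ∀ a b x y → [ a ] ([ b ] (x * y * c)) ≡ [ a ] x * (c * [ b ] y)
    separate a b x y = begin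
      [ a ] ([ b ] (x * y * c))     ≡⟨ trans ([]≡𝟙* a _) (cong (𝟙 a *_) ([]≡𝟙* b _)) ⟩
      𝟙 a * (𝟙 b * (x * y * c))
        ≡⟨ solve 5 (λ s t x y z → s :* (t :* (x :* y :* z)) := s :* x :* (z :* (t :* y))) refl (𝟙 a) (𝟙 b) x y c ⟩
      𝟙 a * x * (c * (𝟙 b * y))     ≡⟨ sym (cong₂ (λ u v → u * (c * v)) ([]≡𝟙* a x) ([]≡𝟙* b y)) ⟩
      [ a ] x * (c * [ b ] y)       ∎

  -- negWeight's summand is local to its definition; unification recovers it.
  negWeight-summand : Σ (Fin n → Fin n → ℚ) λ N → negWeight w vp ≡ pairSum N
  negWeight-summand = _ , refl

  negWeight≡pairSum-negPart : negWeight w vp ≡ pairSum (λ i j → negPart (W i j))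
  negWeight≡pairSum-negPart = trans (proj₂ negWeight-summand) (pairSum-cong agree)
    where
    agree : ∀ i j → proj₁ negWeight-summand i j ≡ negPart (W i j)
    agree i j with W i j <? 0ℚ
    ... | yes _ = refl
    ... | no _ = refl

  frustration≡ : (∀ i j → w i j ≡ w j i) → ∀ x →
    frustration w vp x ≡ 2ℚ * (negWeight w vp - modularity w vp x)
  frustration≡ symmetric x = begin
    frustration w vp x
      ≡⟨ pairSum-cong (λ i j → edgeFrustration (W i j) (x i) (x j)) ⟩
    pairSum (λ i j → 2ℚ * (negPart (W i j) + cut i j))
      ≡⟨ trans (pairSum-distribˡ-* 2ℚ (λ i j → negPart (W i j) + cut i j))
               (cong (2ℚ *_) (pairSum-distrib-+ (λ i j → negPart (W i j)) cut)) ⟩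
    2ℚ * (pairSum (λ i j → negPart (W i j)) + pairSum cut)
      ≡⟨ cong₂ (λ p q → 2ℚ * (p + q)) (sym negWeight≡pairSum-negPart)
               (pairSum-cut W (wt-symmetric symmetric) wt-rowSum≡0 x) ⟩
    2ℚ * (negWeight w vp - internalWeight W x)
      ≡⟨ cong (λ q → 2ℚ * (negWeight w vp - q)) (sym (modularity≡internalWeight x)) ⟩
    2ℚ * (negWeight w vp - modularity w vp x) ∎
    where
    cut : Fin n → Fin n → ℚ
    cut i j = [ x i xor x j ] W i j

proposition4p9 : (n : ℕ) (w : Weights n)
    → (∀ i j → w i j ≡ w j i)
    → (∀ i j → 0ℚ ≤ w i j)
    → (vp : 0ℚ < volV w)
    → (m : ℚ) → IsMax (modularity w vp) m
    → IsMin (frustration w vp) ((1ℚ + 1ℚ) * (negWeight w vp - m))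
proposition4p9 n w symmetric _ vp m maxQ =
  IsMin-cong (λ x → sym (frustration≡ symmetric x))
             (IsMax⇒IsMin-antitone (λ q → 2ℚ * (negWeight w vp - q)) antitone maxQ)
  where
  open WeightedGraph w vp
  antitone : ∀ {p q} → p ≤ q → 2ℚ * (negWeight w vp - q) ≤ 2ℚ * (negWeight w vp - p)
  antitone p≤q = *-monoˡ-≤-nonNeg 2ℚ (+-monoʳ-≤ (negWeight w vp) (neg-antimono-≤ p≤q))
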